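{- Let $P$ be a pattern whose first row, or last row, or first column, or last column consists only of $0$ entries. Then $sat(P,n)=\Theta(n)$.
   Context: All matrices are $0$-$1$ matrices; an $m\times n$ matrix has $m$ rows and $n$ columns. The weight of a matrix is its number of $1$ entries. A pattern is a $0$-$1$ matrix that is not all-zero. A matrix $M$ contains a $k\times l$ pattern $P$ if there are rows $r_1<\dots<r_k$ and columns $c_1<\dots<c_l$ of $M$ such that $M(r_a,c_b)=1$ whenever $P(a,b)=1$; otherwise $M$ avoids $P$. A matrix $M$ is saturating for $P$ if $M$ avoids $P$ and changing any single $0$ entry of $M$ to $1$ yields a matrix containing $P$. $sat(P,m,n)$ is the minimum weight of an $m\times n$ matrix saturating for $P$, and $sat(P,n)=sat(P,n,n)$. -}

module Defs where

open import Data.Bool using (Bool; true; false; if_then_else_; _∧_)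
open import Data.Nat using (ℕ; zero; suc; _+_; _*_; _≤_)
open import Data.Fin using (Fin; toℕ; _≟_) renaming (_<_ to _<ᶠ_)
open import Data.List using (List; map; allFin)
open import Data.Nat.ListAction using (sum)
open import Data.Product using (Σ; ∃; _×_; _,_)
open import Relation.Binary.PropositionalEquality using (_≡_)
open import Relation.Nullary using (¬_)
open import Relation.Nullary.Decidable using (⌊_⌋)

Matrix : ℕ → ℕ → Set
Matrix m n = Fin m → Fin n → Bool

IsPattern : {k l : ℕ} → Matrix k l → Set
IsPattern {k} {l} P = Σ (Fin k) λ a → Σ (Fin l) λ b → P a b ≡ true

weight : {m n : ℕ} → Matrix m n → ℕ
weight {m} {n} M =
  sum (map (λ i → sum (map (λ j → if M i j then 1 else 0) (allFin n))) (allFin m))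

StrictlyIncreasing : {k m : ℕ} → (Fin k → Fin m) → Set
StrictlyIncreasing {k} f = (a a' : Fin k) → a <ᶠ a' → f a <ᶠ f a'

Contains : {m n k l : ℕ} → Matrix m n → Matrix k l → Set
Contains {m} {n} {k} {l} M P =
  Σ (Fin k → Fin m) λ r → Σ (Fin l → Fin n) λ c →
    StrictlyIncreasing r × StrictlyIncreasing c ×
    ((a : Fin k) (b : Fin l) → P a b ≡ true → M (r a) (c b) ≡ true)

Avoids : {m n k l : ℕ} → Matrix m n → Matrix k l → Set
Avoids M P = ¬ Contains M P

setOne : {m n : ℕ} → Matrix m n → Fin m → Fin n → Matrix m n
setOne M i j i' j' = if ⌊ i' ≟ i ⌋ ∧ ⌊ j' ≟ j ⌋ then true else M i' j'

Saturating : {m n k l : ℕ} → Matrix k l → Matrix m n → Set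
Saturating {m} {n} P M =
  Avoids M P × ((i : Fin m) (j : Fin n) → M i j ≡ false → Contains (setOne M i j) P)

FirstRowZero : {k l : ℕ} → Matrix k l → Set
FirstRowZero {k} {l} P = (a : Fin k) → toℕ a ≡ 0 → (b : Fin l) → P a b ≡ false

LastRowZero : {k l : ℕ} → Matrix k l → Set
LastRowZero {k} {l} P = (a : Fin k) → suc (toℕ a) ≡ k → (b : Fin l) → P a b ≡ false

FirstColumnZero : {k l : ℕ} → Matrix k l → Set
FirstColumnZero {k} {l} P = (b : Fin l) → toℕ b ≡ 0 → (a : Fin k) → P a b ≡ false

LastColumnZero : {k l : ℕ} → Matrix k l → Set
LastColumnZero {k} {l} P = (b : Fin l) → suc (toℕ b) ≡ l → (a : Fin k) → P a b ≡ false

-- sat(P , n) ≤ c : some n × n saturating matrix has weight ≤ c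
-- (literal unfolding of "the minimum weight is ≤ c").
SatAtMost : {k l : ℕ} → Matrix k l → ℕ → ℕ → Set
SatAtMost P n c = Σ (Matrix n n) λ M → Saturating P M × weight M ≤ c

-- c ≤ sat(P , n) : every n × n saturating matrix has weight ≥ c.
SatAtLeast : {k l : ℕ} → Matrix k l → ℕ → ℕ → Set
SatAtLeast P n c = (M : Matrix n n) → Saturating P M → c ≤ weight M

-- sat(P , n) = Θ(n): there are constants a , b ≥ 1 and N such that for all n ≥ N,
-- n / a ≤ sat(P , n) ≤ b n  (positive real constants replaced by naturals; equivalent).
SatTheta : {k l : ℕ} → Matrix k l → Set
SatTheta P = Σ ℕ λ a → Σ ℕ λ b → Σ ℕ λ N →
  (n : ℕ) → N ≤ n →
    SatAtMost P n (b * n) × ((M : Matrix n n) → Saturating P M → n ≤ a * weight M)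
-- (the second component says n ≤ a · sat(P , n), i.e. sat(P , n) ≥ n / a.)

{-# OPTIONS --safe #-}

-- Lower bound: if, say, the first row of P is zero, no copy of P uses a 1 in the first row
-- of M, so in a saturating M every entry of that row is 1.
-- Upper bound: fix a 1 of P at (a , b) and fill with 1s the first a and last k − 1 − a rows
-- and the first b and last l − 1 − b columns (0-based). Any copy of P sends (a , b) to a 0
-- of this frame, so the frame avoids P; conversely every 0 is the image of (a , b) in a copy
-- whose other rows and columns lie in the frame. The frame has at most (k + l) n ones.

module Submission where

open import Defs
open import Data.Sum using (_⊎_; inj₁; inj₂)
open import Data.Bool using (Bool; true; false; if_then_else_; _∨_)
open import Data.Bool.Properties using (not-¬)
open import Data.Nat using (ℕ; zero; suc; _+_; _*_; _≤_; _<_; z≤n; s≤s)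
open import Data.Nat.Properties hiding (_≟_; <-cmp)
open import Data.Fin using (Fin; zero; suc; toℕ; opposite; inject₁; inject≤; _≟_)
  renaming (_<_ to _<ᶠ_)
open import Data.Fin.Properties
  using (toℕ<n; toℕ-inject₁; toℕ-inject≤; opposite-prop; opposite-involutive; <-cmp)
open import Data.Fin.Permutation using (reverse)
import Data.List as List using (tabulate; map; allFin)
open import Data.List.Properties using (map-tabulate)
import Data.Nat.ListAction as List
open import Algebra.Properties.Semiring.Sum +-*-semiring
open import Data.Product using (Σ; _×_; _,_; proj₁; proj₂)
open import Data.Empty using (⊥-elim)
open import Function using (_∘_; id)
open import Relation.Binary.Definitions using (tri<; tri≈; tri>)
open import Relation.Binary.PropositionalEquality
open import Relation.Nullary using (¬_; yes; no; contradiction)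
open import Relation.Nullary.Decidable using (Dec; does; _⊎-dec_; dec-true; dec-false)

ind : Bool → ℕ
ind b = if b then 1 else 0

ind-∨ : ∀ x y → ind (x ∨ y) ≤ ind x + ind y
ind-∨ true  y = s≤s z≤n
ind-∨ false y = ≤-refl

sum-tabulate : ∀ {n} (f : Fin n → ℕ) → List.sum (List.tabulate f) ≡ sum f
sum-tabulate {zero}  f = refl
sum-tabulate {suc n} f = cong (f zero +_) (sum-tabulate (f ∘ suc))

sum-map-allFin : ∀ {n} (f : Fin n → ℕ) → List.sum (List.map f (List.allFin n)) ≡ sum f
sum-map-allFin f = trans (cong List.sum (map-tabulate id f)) (sum-tabulate f)

sum-mono-≤ : ∀ {n} {f g : Fin n → ℕ} → (∀ i → f i ≤ g i) → sum f ≤ sum g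
sum-mono-≤ {zero}  f≤g = z≤n
sum-mono-≤ {suc n} f≤g = +-mono-≤ (f≤g zero) (sum-mono-≤ (f≤g ∘ suc))

sum-const : ∀ n x → ∑[ _ < n ] x ≡ n * x
sum-const zero    x = refl
sum-const (suc n) x = cong (x +_) (sum-const n x)

term≤sum : ∀ {n} (f : Fin n → ℕ) i → f i ≤ sum f
term≤sum {suc n} f i = ≤-trans (m≤m+n (f i) _) (≤-reflexive (sym (sum-remove {i = i} f)))

count : ∀ {n} → (Fin n → Bool) → ℕ
count {n} p = ∑[ v < n ] ind (p v)

count-∨ : ∀ {n} (p q : Fin n → Bool) → count (λ v → p v ∨ q v) ≤ count p + count q
count-∨ p q = ≤-trans (sum-mono-≤ (λ v → ind-∨ (p v) (q v)))
                      (≤-reflexive (∑-distrib-+ (ind ∘ p) (ind ∘ q)))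

count-full : ∀ {n} {p : Fin n → Bool} → (∀ v → p v ≡ true) → count p ≡ n
count-full {n} full = trans (sum-cong-≗ (cong ind ∘ full)) (trans (sum-const n 1) (*-identityʳ n))

count-< : ∀ n x → count {n} (λ v → does (toℕ v <? x)) ≤ x
count-< zero    x       = z≤n
count-< (suc n) zero    = count-< n zero
count-< (suc n) (suc x) = s≤s (count-< n x)

module _ {m n : ℕ} where

  weight≡∑count : (M : Matrix m n) → weight M ≡ ∑[ i < m ] count (M i)
  weight≡∑count M = trans (sum-map-allFin (λ i → List.sum (List.map (ind ∘ M i) (List.allFin n))))
                          (sum-cong-≗ (λ i → sum-map-allFin (ind ∘ M i)))

  weight-∨ : (M N : Matrix m n) → weight (λ i j → M i j ∨ N i j) ≤ weight M + weight N
  weight-∨ M N = begin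
    weight (λ i j → M i j ∨ N i j)             ≡⟨ weight≡∑count _ ⟩
    ∑[ i < m ] count (λ j → M i j ∨ N i j)     ≤⟨ sum-mono-≤ (λ i → count-∨ (M i) (N i)) ⟩
    ∑[ i < m ] (count (M i) + count (N i))     ≡⟨ ∑-distrib-+ (count ∘ M) (count ∘ N) ⟩
    ∑[ i < m ] count (M i) + ∑[ i < m ] count (N i)
                                               ≡⟨ cong₂ _+_ (weight≡∑count M) (weight≡∑count N) ⟨
    weight M + weight N                        ∎
    where open ≤-Reasoning

  weight-rows : (R : Fin m → Bool) → weight {m} {n} (λ i _ → R i) ≡ n * count R
  weight-rows R = begin
    weight {m} {n} (λ i _ → R i)       ≡⟨ weight≡∑count _ ⟩
    ∑[ i < m ] count {n} (λ _ → R i)  ≡⟨ sum-cong-≗ (λ i → sum-const n (ind (R i))) ⟩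
    ∑[ i < m ] (n * ind (R i))        ≡⟨ *-distribˡ-sum n (ind ∘ R) ⟨
    n * count R                        ∎
    where open ≡-Reasoning

  weight-cols : (C : Fin n → Bool) → weight {m} {n} (λ _ j → C j) ≡ m * count C
  weight-cols C = trans (weight≡∑count _) (sum-const m (count C))

  full-row⇒n≤weight : (M : Matrix m n) (i : Fin m) → (∀ j → M i j ≡ true) → n ≤ weight M
  full-row⇒n≤weight M i full = begin
    n                       ≡⟨ count-full full ⟨
    count (M i)             ≤⟨ term≤sum (count ∘ M) i ⟩
    ∑[ i < m ] count (M i)  ≡⟨ weight≡∑count M ⟨
    weight M                ∎
    where open ≤-Reasoning

  full-col⇒m≤weight : (M : Matrix m n) (j : Fin n) → (∀ i → M i j ≡ true) → m ≤ weight M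
  full-col⇒m≤weight M j full = begin
    m                       ≡⟨ count-full full ⟨
    count (λ i → M i j)     ≤⟨ sum-mono-≤ (λ i → term≤sum (ind ∘ M i) j) ⟩
    ∑[ i < m ] count (M i)  ≡⟨ weight≡∑count M ⟨
    weight M                ∎
    where open ≤-Reasoning

suc-toℕ+toℕ-opposite : ∀ {n} (i : Fin n) → suc (toℕ i) + toℕ (opposite i) ≡ n
suc-toℕ+toℕ-opposite i = trans (cong (suc (toℕ i) +_) (opposite-prop i)) (m+[n∸m]≡n (toℕ<n i))

opposite-< : ∀ {n} {i j : Fin n} → i <ᶠ j → opposite j <ᶠ opposite i
opposite-< {i = i} {j} i<j =
  subst₂ _<_ (sym (opposite-prop j)) (sym (opposite-prop i)) (∸-monoʳ-< (s≤s i<j) (toℕ<n j))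

opposite-<-reflect : ∀ {n} {i j : Fin n} → opposite i <ᶠ opposite j → j <ᶠ i
opposite-<-reflect {i = i} {j} p =
  subst₂ _<ᶠ_ (opposite-involutive j) (opposite-involutive i) (opposite-< p)

incr-opposite : ∀ {k m} {f : Fin k → Fin m} → StrictlyIncreasing f →
                StrictlyIncreasing (opposite ∘ f ∘ opposite)
incr-opposite inc x y x<y = opposite-< (inc _ _ (opposite-< x<y))

incr-≥ : ∀ {k m} {f : Fin k → Fin m} → StrictlyIncreasing f → ∀ a → toℕ a ≤ toℕ (f a)
incr-≥ inc zero = z≤n
incr-≥ {f = f} inc (suc a) = ≤-<-trans (incr-≥ inc-inject₁ a) (inc (inject₁ a) (suc a) inject₁<suc)
  where
  inject₁<suc : inject₁ a <ᶠ suc a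
  inject₁<suc = s≤s (≤-reflexive (toℕ-inject₁ a))
  inc-inject₁ : StrictlyIncreasing (f ∘ inject₁)
  inc-inject₁ x y x<y =
    inc (inject₁ x) (inject₁ y) (subst₂ _<_ (sym (toℕ-inject₁ x)) (sym (toℕ-inject₁ y)) x<y)

incr-opposite-≥ : ∀ {k m} {f : Fin k → Fin m} → StrictlyIncreasing f →
                  ∀ a → toℕ (opposite a) ≤ toℕ (opposite (f a))
incr-opposite-≥ {f = f} inc a =
  subst (λ v → toℕ (opposite a) ≤ toℕ (opposite (f v)))
        (opposite-involutive a) (incr-≥ (incr-opposite inc) (opposite a))

incr-first : ∀ {k m} {f : Fin k → Fin (suc m)} → StrictlyIncreasing f →
             ∀ {a} → f a ≡ zero → toℕ a ≡ 0
incr-first inc {a} fa≡0 = n≤0⇒n≡0 (subst (λ v → toℕ a ≤ toℕ v) fa≡0 (incr-≥ inc a))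

incr-last : ∀ {k m} {f : Fin k → Fin (suc m)} → StrictlyIncreasing f →
            ∀ {a} → f a ≡ opposite zero → suc (toℕ a) ≡ k
incr-last {k} inc {a} fa≡last = begin
  suc (toℕ a)                     ≡⟨ +-identityʳ _ ⟨
  suc (toℕ a) + 0                 ≡⟨ cong (suc (toℕ a) +_) opposite-a≡0 ⟨
  suc (toℕ a) + toℕ (opposite a)  ≡⟨ suc-toℕ+toℕ-opposite a ⟩
  k                               ∎
  where
  open ≡-Reasoning
  opposite-a≡0 : toℕ (opposite a) ≡ 0
  opposite-a≡0 = n≤0⇒n≡0 (≤-trans (incr-opposite-≥ inc a) (≤-reflexive
    (trans (cong (toℕ ∘ opposite) fa≡last) (cong toℕ (opposite-involutive zero)))))

module _ {m n : ℕ} (M : Matrix m n) (i : Fin m) (j : Fin n) where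

  setOne-unchanged : ∀ {i′ j′} → i′ ≢ i ⊎ j′ ≢ j → setOne M i j i′ j′ ≡ M i′ j′
  setOne-unchanged {i′} {j′} ne with i′ ≟ i | j′ ≟ j | ne
  ... | no _     | _        | _          = refl
  ... | yes _    | no _     | _          = refl
  ... | yes i′≡i | yes _    | inj₁ i′≢i = contradiction i′≡i i′≢i
  ... | yes _    | yes j′≡j | inj₂ j′≢j = contradiction j′≡j j′≢j

  setOne-hit : setOne M i j i j ≡ true
  setOne-hit with i ≟ i | j ≟ j
  ... | yes _ | yes _ = refl
  ... | no i≢i | _    = contradiction refl i≢i
  ... | yes _ | no j≢j = contradiction refl j≢j

  setOne-true : ∀ {i′ j′} → M i′ j′ ≡ true → setOne M i j i′ j′ ≡ true
  setOne-true {i′} {j′} one with i′ ≟ i | j′ ≟ j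
  ... | yes _ | yes _ = refl
  ... | yes _ | no _  = one
  ... | no _  | _     = one

module _ {k l m n : ℕ} {P : Matrix k l} {M : Matrix m n} (sat : Saturating P M) where

  saturating-forced : ∀ {i j} →
    (∀ r c → StrictlyIncreasing r → StrictlyIncreasing c →
       ∀ a b → P a b ≡ true → r a ≢ i ⊎ c b ≢ j) →
    M i j ≡ true
  saturating-forced {i} {j} unhit with M i j in zero-entry
  ... | true  = refl
  ... | false with proj₂ sat i j zero-entry
  ...   | r , c , r-inc , c-inc , copy = ⊥-elim (proj₁ sat (r , c , r-inc , c-inc , copy′))
    where
    copy′ : ∀ a b → P a b ≡ true → M (r a) (c b) ≡ true
    copy′ a b p = trans (sym (setOne-unchanged M i j (unhit r c r-inc c-inc a b p))) (copy a b p)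

  saturating-full-row : ∀ {i} → (∀ r → StrictlyIncreasing r → ∀ a b → P a b ≡ true → r a ≢ i) →
                        ∀ j → M i j ≡ true
  saturating-full-row unhit j = saturating-forced λ r c r-inc _ a b p → inj₁ (unhit r r-inc a b p)

  saturating-full-col : ∀ {j} → (∀ c → StrictlyIncreasing c → ∀ a b → P a b ≡ true → c b ≢ j) →
                        ∀ i → M i j ≡ true
  saturating-full-col unhit i = saturating-forced λ r c _ c-inc a b p → inj₂ (unhit c c-inc a b p)

saturating⇒n≤weight : ∀ {k l n} {P : Matrix k l} →
  FirstRowZero P ⊎ LastRowZero P ⊎ FirstColumnZero P ⊎ LastColumnZero P →
  (M : Matrix n n) → Saturating P M → n ≤ weight M
saturating⇒n≤weight {n = zero} _ _ _ = z≤n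
saturating⇒n≤weight {n = suc n} (inj₁ first) M sat =
  full-row⇒n≤weight M zero (saturating-full-row sat λ r inc a b p ra≡first →
    not-¬ p (first a (incr-first inc ra≡first) b))
saturating⇒n≤weight {n = suc n} (inj₂ (inj₁ last)) M sat =
  full-row⇒n≤weight M (opposite zero) (saturating-full-row sat λ r inc a b p ra≡last →
    not-¬ p (last a (incr-last inc ra≡last) b))
saturating⇒n≤weight {n = suc n} (inj₂ (inj₂ (inj₁ first))) M sat =
  full-col⇒m≤weight M zero (saturating-full-col sat λ c inc a b p cb≡first →
    not-¬ p (first b (incr-first inc cb≡first) a))
saturating⇒n≤weight {n = suc n} (inj₂ (inj₂ (inj₂ last))) M sat =
  full-col⇒m≤weight M (opposite zero) (saturating-full-col sat λ c inc a b p cb≡last →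
    not-¬ p (last b (incr-last inc cb≡last) a))

Rim : ∀ {k n} → Fin k → Fin n → Set
Rim a v = toℕ v < toℕ a ⊎ toℕ (opposite v) < toℕ (opposite a)

rim? : ∀ {k n} (a : Fin k) (v : Fin n) → Dec (Rim a v)
rim? a v = toℕ v <? toℕ a ⊎-dec toℕ (opposite v) <? toℕ (opposite a)

rim-count : ∀ {k} n (a : Fin k) → count {n} (does ∘ rim? a) ≤ k
rim-count {k} n a = begin
  count {n} (does ∘ rim? a)                ≤⟨ count-∨ before (after ∘ opposite) ⟩
  count before + count (after ∘ opposite)  ≡⟨ cong (count before +_) (sum-permute (ind ∘ after) reverse) ⟨
  count before + count after               ≤⟨ +-mono-≤ (count-< n A) (count-< n D) ⟩
  A + D                                    <⟨ n<1+n (A + D) ⟩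
  suc A + D                                ≡⟨ suc-toℕ+toℕ-opposite a ⟩
  k                                        ∎
  where
  open ≤-Reasoning
  A = toℕ a
  D = toℕ (opposite a)
  before after : Fin n → Bool
  before v = does (toℕ v <? A)
  after v = does (toℕ v <? D)

incr-off-rim : ∀ {k m} {f : Fin k → Fin m} → StrictlyIncreasing f → ∀ a → ¬ Rim a (f a)
incr-off-rim inc a (inj₁ before) = <⇒≱ before (incr-≥ inc a)
incr-off-rim inc a (inj₂ after)  = <⇒≱ after (incr-opposite-≥ inc a)

module RimEmbedding {k n : ℕ} (a : Fin k) (i : Fin n) (off : ¬ Rim a i) where

  a≤i : toℕ a ≤ toℕ i
  a≤i = ≮⇒≥ (off ∘ inj₁)

  opposite-a≤i : toℕ (opposite a) ≤ toℕ (opposite i)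
  opposite-a≤i = ≮⇒≥ (off ∘ inj₂)

  k≤n : k ≤ n
  k≤n = subst₂ _≤_ (suc-toℕ+toℕ-opposite a) (suc-toℕ+toℕ-opposite i)
                   (s≤s (+-mono-≤ a≤i opposite-a≤i))

  low : Fin k → Fin n
  low x = inject≤ x k≤n

  high : Fin k → Fin n
  high x = opposite (inject≤ (opposite x) k≤n)

  toℕ-opposite-high : ∀ x → toℕ (opposite (high x)) ≡ toℕ (opposite x)
  toℕ-opposite-high x =
    trans (cong toℕ (opposite-involutive _)) (toℕ-inject≤ (opposite x) k≤n)

  low<i : ∀ {x} → x <ᶠ a → low x <ᶠ i
  low<i {x} x<a = <-≤-trans (subst (_< toℕ a) (sym (toℕ-inject≤ x k≤n)) x<a) a≤i

  i<high : ∀ {x} → a <ᶠ x → i <ᶠ high x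
  i<high {x} a<x = opposite-<-reflect
    (<-≤-trans (subst (_< toℕ (opposite a)) (sym (toℕ-opposite-high x)) (opposite-< a<x))
               opposite-a≤i)

  embed : Fin k → Fin n
  embed x with <-cmp x a
  ... | tri< _ _ _ = low x
  ... | tri≈ _ _ _ = i
  ... | tri> _ _ _ = high x

  embed-at : embed a ≡ i
  embed-at with <-cmp a a
  ... | tri< a<a _ _ = contradiction a<a (<-irrefl refl)
  ... | tri≈ _ _ _   = refl
  ... | tri> _ _ a<a = contradiction a<a (<-irrefl refl)

  embed-rim : ∀ x → x ≢ a → Rim a (embed x)
  embed-rim x x≢a with <-cmp x a
  ... | tri< x<a _ _ = inj₁ (subst (_< toℕ a) (sym (toℕ-inject≤ x k≤n)) x<a)
  ... | tri≈ _ x≡a _ = contradiction x≡a x≢a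
  ... | tri> _ _ a<x = inj₂ (subst (_< toℕ (opposite a)) (sym (toℕ-opposite-high x)) (opposite-< a<x))

  embed-incr : StrictlyIncreasing embed
  embed-incr x y x<y with <-cmp x a | <-cmp y a
  ... | tri< _ _ _    | tri< _ _ _    =
    subst₂ _<_ (sym (toℕ-inject≤ x k≤n)) (sym (toℕ-inject≤ y k≤n)) x<y
  ... | tri< x<a _ _  | tri≈ _ _ _    = low<i x<a
  ... | tri< x<a _ _  | tri> _ _ a<y  = <-trans (low<i x<a) (i<high a<y)
  ... | tri≈ _ refl _ | tri< y<a _ _  = contradiction x<y (<-asym y<a)
  ... | tri≈ _ refl _ | tri≈ _ refl _ = contradiction x<y (<-irrefl refl)
  ... | tri≈ _ _ _    | tri> _ _ a<y  = i<high a<y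
  ... | tri> _ _ a<x  | tri< y<a _ _  = contradiction (<-trans a<x x<y) (<-asym y<a)
  ... | tri> _ _ a<x  | tri≈ _ refl _ = contradiction a<x (<-asym x<y)
  ... | tri> _ _ _    | tri> _ _ _    = opposite-<-reflect
    (subst₂ _<_ (sym (toℕ-opposite-high y)) (sym (toℕ-opposite-high x)) (opposite-< x<y))

rim-embedding : ∀ {k n} (a : Fin k) (i : Fin n) → ¬ Rim a i →
  Σ (Fin k → Fin n) λ r → StrictlyIncreasing r × r a ≡ i × (∀ x → x ≢ a → Rim a (r x))
rim-embedding a i off = embed , embed-incr , embed-at , embed-rim
  where open RimEmbedding a i off

frame : ∀ {k l m n} → Fin k → Fin l → Matrix m n
frame a b i j = does (rim? a i ⊎-dec rim? b j)

module _ {k l m n : ℕ} {P : Matrix k l} {a : Fin k} {b : Fin l} (one : P a b ≡ true) where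

  frame-avoids : Avoids (frame {m = m} {n} a b) P
  frame-avoids (r , c , r-inc , c-inc , copy) =
    not-¬ (copy a b one) (dec-false (rim? a (r a) ⊎-dec rim? b (c b)) off)
    where
    off : ¬ (Rim a (r a) ⊎ Rim b (c b))
    off (inj₁ rim) = incr-off-rim r-inc a rim
    off (inj₂ rim) = incr-off-rim c-inc b rim

  frame-saturating : Saturating P (frame {m = m} {n} a b)
  frame-saturating = frame-avoids , completes
    where
    completes : ∀ i j → frame a b i j ≡ false → Contains (setOne (frame a b) i j) P
    completes i j zero-entry
      with rim-embedding a i (off ∘ inj₁) | rim-embedding b j (off ∘ inj₂)
      where
      off : ¬ (Rim a i ⊎ Rim b j)
      off rim = not-¬ (dec-true (rim? a i ⊎-dec rim? b j) rim) zero-entry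
    ... | r , r-inc , r-at , r-rim | c , c-inc , c-at , c-rim = r , c , r-inc , c-inc , covered
      where
      on-frame : ∀ x y → Rim a (r x) ⊎ Rim b (c y) → setOne (frame a b) i j (r x) (c y) ≡ true
      on-frame x y rim = setOne-true (frame a b) i j (dec-true (rim? a (r x) ⊎-dec rim? b (c y)) rim)
      covered : ∀ x y → P x y ≡ true → setOne (frame a b) i j (r x) (c y) ≡ true
      covered x y _ with x ≟ a | y ≟ b
      ... | no x≢a   | _        = on-frame x y (inj₁ (r-rim x x≢a))
      ... | yes _    | no y≢b   = on-frame x y (inj₂ (c-rim y y≢b))
      ... | yes refl | yes refl rewrite r-at | c-at = setOne-hit (frame a b) i j

frame-weight : ∀ {k l m n} (a : Fin k) (b : Fin l) → weight (frame {m = m} {n} a b) ≤ n * k + m * l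
frame-weight {k} {l} {m} {n} a b = begin
  weight (frame {m = m} {n} a b)
    ≤⟨ weight-∨ {m} {n} (λ i _ → does (rim? a i)) (λ _ j → does (rim? b j)) ⟩
  weight {m} {n} (λ i _ → does (rim? a i)) + weight {m} {n} (λ _ j → does (rim? b j))
    ≡⟨ cong₂ _+_ (weight-rows {m} {n} (does ∘ rim? a)) (weight-cols {m} {n} (does ∘ rim? b)) ⟩
  n * count {m} (does ∘ rim? a) + m * count {n} (does ∘ rim? b)
    ≤⟨ +-mono-≤ (*-monoʳ-≤ n (rim-count m a)) (*-monoʳ-≤ m (rim-count n b)) ⟩
  n * k + m * l ∎
  where open ≤-Reasoning

theorem4 : {k l : ℕ} (P : Matrix k l) → IsPattern P →
    (FirstRowZero P ⊎ LastRowZero P ⊎ FirstColumnZero P ⊎ LastColumnZero P) →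
    SatTheta P
theorem4 {k} {l} P (a , b , one) zero-line = 1 , k + l , 0 , λ n _ →
  (frame a b , frame-saturating {m = n} {n} one , square-frame-weight n) ,
  λ M sat → ≤-trans (saturating⇒n≤weight zero-line M sat) (≤-reflexive (sym (*-identityˡ _)))
  where
  square-frame-weight : ∀ n → weight (frame {m = n} {n} a b) ≤ (k + l) * n
  square-frame-weight n =
    ≤-trans (frame-weight {m = n} {n} a b)
            (≤-reflexive (trans (sym (*-distribˡ-+ n k l)) (*-comm n (k + l))))
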